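{- Let $n\geq 3$ be an integer and let $\mathcal{Q}=\mathcal{Q}_1\mathcal{Q}_2$ be an admissible path of $l<n$ primes, where $\mathcal{Q}_1$ and $\mathcal{Q}_2$ are nonempty paths. Let $\delta=|f(\mathcal{Q}_2)-\ell(\mathcal{Q}_1)|$ be the gap between $\mathcal{Q}_1$ and $\mathcal{Q}_2$. Then: (A1) If $|f(\mathcal{Q}_2)-f(\mathcal{Q}_1)|\in F_g(\mathcal{Q})$, then the path $\mathcal{Q}^*=\overline{\mathcal{Q}}_1\mathcal{Q}_2$ is admissible and $F_g(\mathcal{Q}^*)=F_g(\mathcal{Q})\cup\{\delta\}\setminus\{|f(\mathcal{Q}_2)-f(\mathcal{Q}_1)|\}$. (A2) If $|\ell(\mathcal{Q}_2)-\ell(\mathcal{Q}_1)|\in F_g(\mathcal{Q})$, then the path $\mathcal{Q}^*=\mathcal{Q}_1\overline{\mathcal{Q}}_2$ is admissible and $F_g(\mathcal{Q}^*)=F_g(\mathcal{Q})\cup\{\delta\}\setminus\{|\ell(\mathcal{Q}_2)-\ell(\mathcal{Q}_1)|\}$. (A3) If $|\ell(\mathcal{Q}_2)-f(\mathcal{Q}_1)|\in F_g(\mathcal{Q})$, then the path $\mathcal{Q}^*=\mathcal{Q}_2\mathcal{Q}_1$ is admissible and $F_g(\mathcal{Q}^*)=F_g(\mathcal{Q})\cup\{\delta\}\setminus\{|\ell(\mathcal{Q}_2)-f(\mathcal{Q}_1)|\}$. (A4) If $|\ell(\mathcal{Q}_2)-f(\mathcal{Q}_1)|=\delta$, then the path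 $\mathcal{Q}^*=\mathcal{Q}_2\mathcal{Q}_1$ is admissible and $F_g(\mathcal{Q}^*)=F_g(\mathcal{Q})$.
   Context: Let $p_1=3<p_2=5<p_3=7<\cdots$ be the increasing sequence of odd primes and $\mathbb{P}_n=\{p_1,\dots,p_n\}$. A path of $l$ primes $\mathcal{Q}=q_1q_2\ldots q_l$ is a finite sequence of primes (labels of the vertices of a path graph, in order). It is admissible (with respect to the fixed $n$) if the $q_i\in\mathbb{P}_n$ are distinct and the set $E_l$ of the $l-1$ gaps $|q_{i+1}-q_i|$ ($1\le i\le l-1$) is a subset of cardinality $l-1$ of $\{2,4,\ldots,2n-2\}$ (i.e. the gaps are pairwise distinct and lie in that set). A gap $2k\le 2n-2$ is free for $\mathcal{Q}$ if it does not belong to $E_l$; $F_g(\mathcal{Q})$ denotes the set of free gaps. Notation: $\overline{\mathcal{Q}}=q_lq_{l-1}\ldots q_1$ is the reversed path; $\mathcal{Q}_1\mathcal{Q}_2$ is concatenation; $f(\mathcal{Q})=q_1$ and $\ell(\mathcal{Q})=q_l$ are the first and last primes. -}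

module Defs where

open import Data.Nat using (ℕ; zero; suc; _+_; _*_; _∸_; _≤_; _<_; ∣_-_∣)
open import Data.Nat.Primality using (Prime; prime?)
open import Data.List using (List; []; _∷_; length; upTo; filter)
open import Data.List.Relation.Unary.All using (All)
open import Data.List.Relation.Unary.Unique.Propositional using (Unique)
open import Data.List.Membership.Propositional using (_∈_; _∉_)
open import Data.Product using (_×_; ∃)
open import Data.Sum using (_⊎_)
open import Relation.Nullary using (¬_; Dec; yes; no)
open import Relation.Nullary.Decidable using (_×-dec_; ¬?)
open import Relation.Binary.PropositionalEquality using (_≡_; _≢_)
open import Data.Nat.Properties using (_≟_)

OddPrime : ℕ → Set
OddPrime q = Prime q × ¬ (q ≡ 2)

oddPrime? : (q : ℕ) → Dec (OddPrime q)
oddPrime? q = prime? q ×-dec ¬? (q ≟ 2)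

countOddPrimesBelow : ℕ → ℕ
countOddPrimesBelow q = length (filter oddPrime? (upTo q))

-- q is the k-th odd prime p_k (1-indexed: p_1 = 3, p_2 = 5, ...):
-- q is an odd prime with exactly k - 1 odd primes below it.
IsOddPrimeNo : ℕ → ℕ → Set
IsOddPrimeNo k q = OddPrime q × countOddPrimesBelow q ≡ k ∸ 1

InP : ℕ → ℕ → Set
InP n q = ∃ λ k → 1 ≤ k × k ≤ n × IsOddPrimeNo k q

gaps : List ℕ → List ℕ
gaps []           = []
gaps (a ∷ [])     = []
gaps (a ∷ b ∷ qs) = ∣ b - a ∣ ∷ gaps (b ∷ qs)

AllowedGap : ℕ → ℕ → Set
AllowedGap n g = (∃ λ k → g ≡ 2 * k) × 2 ≤ g × g ≤ 2 * n ∸ 2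

Admissible : ℕ → List ℕ → Set
Admissible n Q = All (InP n) Q × Unique Q × Unique (gaps Q) × All (AllowedGap n) (gaps Q)

Free : ℕ → List ℕ → ℕ → Set
Free n Q g = AllowedGap n g × g ∉ gaps Q

module Submission where

-- Every rearrangement Q* in (A1)–(A4) has the same vertices as Q up to
-- permutation, so the distinctness of the primes and their membership in ℙₙ
-- carry over.  For the gaps, write R for the multiset of gaps inside Q₁ and
-- inside Q₂ (inner-gaps); reversing a path reverses the order of its gaps, and
-- concatenating nonempty paths A, B adds exactly the junction gap |f(B) − ℓ(A)|.
-- Hence the gap list of Q is a permutation of δ ∷ R, and that of Q* a
-- permutation of g* ∷ R, where g* is the new junction gap.  In (A1)–(A3) g* is
-- free for Q, so exchanging δ for g* keeps the gaps distinct and allowed and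
-- changes the set of free gaps by adding δ and removing g*; in (A4) g* = δ and
-- the gap lists are permutations of each other.

open import Defs
open import Data.Nat using (ℕ; _≤_; _<_; ∣_-_∣; _≟_)
open import Data.Nat.Properties using (∣-∣-comm)
open import Data.List using (List; []; _∷_; [_]; length; _++_)
import Data.List as List
open import Data.List.Properties
  using (++-assoc; reverse-++; unfold-reverse; ∷-injectiveˡ; ∷ʳ-injectiveʳ)
open import Data.List.NonEmpty using (List⁺; head; last; toList; reverse; snocView; _∷ʳ′_)
import Data.List.NonEmpty as List⁺
open import Data.List.Relation.Unary.All using (All; _∷_)
open import Data.List.Relation.Unary.All.Properties using (¬Any⇒All¬; All¬⇒¬Any)
open import Data.List.Relation.Unary.Any using (here; there)
open import Data.List.Relation.Unary.AllPairs using (_∷_)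
open import Data.List.Relation.Unary.Unique.Propositional using (Unique)
open import Data.List.Membership.Propositional using (_∉_)
open import Data.List.Relation.Binary.Permutation.Propositional
  using (_↭_; ↭-sym; ↭-trans; ↭-reflexive; ↭-prep; ↭⇒↭ₛ; module PermutationReasoning)
open import Data.List.Relation.Binary.Permutation.Propositional.Properties
  using (All-resp-↭; ∈-resp-↭; shift; ++-comm; ++⁺ˡ; ++⁺ʳ; ↭-reverse)
import Data.List.Relation.Binary.Permutation.Setoid.Properties as SetoidPermutation
import Data.Vec as Vec
import Data.Vec.Properties as Vec
open import Data.Product using (_×_; _,_; ∃)
open import Data.Product.Function.NonDependent.Propositional using (_×-⇔_)
open import Data.Sum using (_⊎_; inj₁; inj₂)
open import Data.Sum.Function.Propositional using (_⊎-⇔_)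
open import Function using (_∘_)
open import Function.Bundles using (_⇔_; mk⇔; Equivalence)
import Function.Properties.Equivalence as ⇔
open import Relation.Nullary using (yes; no)
open import Relation.Binary.Definitions using (DecidableEquality)
open import Relation.Binary.PropositionalEquality
  using (_≡_; _≢_; refl; sym; trans; cong; cong₂; setoid; module ≡-Reasoning)


FreeIn : {A : Set} → (A → Set) → List A → A → Set
FreeIn P G g = P g × g ∉ G

Unique-resp-↭ : {A : Set} {xs ys : List A} → xs ↭ ys → Unique xs → Unique ys
Unique-resp-↭ {A} = SetoidPermutation.Unique-resp-↭ (setoid A) ∘ ↭⇒↭ₛ

module _ {A : Set} {P : A → Set} where

  free-↭ : ∀ {G H g} → G ↭ H → FreeIn P G g ⇔ FreeIn P H g
  free-↭ G↭H = mk⇔ (λ (p , g∉G) → p , g∉G ∘ ∈-resp-↭ (↭-sym G↭H))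
                   (λ (p , g∉H) → p , g∉H ∘ ∈-resp-↭ G↭H)

  free-∷ : ∀ {x R g} → FreeIn P (x ∷ R) g ⇔ (FreeIn P R g × g ≢ x)
  free-∷ = mk⇔ (λ (p , g∉xR) → (p , g∉xR ∘ there) , g∉xR ∘ here)
               (λ ((p , g∉R) , g≢x) → p , λ { (here g≡x) → g≢x g≡x ; (there g∈R) → g∉R g∈R })

  free-remove : DecidableEquality A → ∀ {δ R g} → P δ → δ ∉ R →
    (FreeIn P (δ ∷ R) g ⊎ g ≡ δ) ⇔ FreeIn P R g
  free-remove _≟_ {δ} {R} {g} pδ δ∉R = mk⇔ to from
    where
    to : FreeIn P (δ ∷ R) g ⊎ g ≡ δ → FreeIn P R g
    to (inj₁ free) with Equivalence.to free-∷ free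
    ... | freeR , _ = freeR
    to (inj₂ refl) = pδ , δ∉R
    from : FreeIn P R g → FreeIn P (δ ∷ R) g ⊎ g ≡ δ
    from freeR with g ≟ δ
    ... | yes g≡δ = inj₂ g≡δ
    ... | no g≢δ  = inj₁ (Equivalence.from free-∷ (freeR , g≢δ))

  exchange : DecidableEquality A → ∀ {G G* R δ g*} → G ↭ δ ∷ R → G* ↭ g* ∷ R →
    Unique G → All P G → FreeIn P G g* →
    (Unique G* × All P G*) × (∀ g → FreeIn P G* g ⇔ ((FreeIn P G g ⊎ g ≡ δ) × g ≢ g*))
  exchange _≟_ {G = G} {R = R} {δ = δ} {g* = g*} G↭δR G*↭g*R uG allG (pg* , g*∉G)
    with Unique-resp-↭ G↭δR uG | All-resp-↭ G↭δR allG
  ... | δ≢R ∷ uR | pδ ∷ allR =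
    (Unique-resp-↭ (↭-sym G*↭g*R) (¬Any⇒All¬ R g*∉R ∷ uR) , All-resp-↭ (↭-sym G*↭g*R) (pg* ∷ allR))
    , λ g → ⇔.trans (free-↭ G*↭g*R) (⇔.trans free-∷ (⇔.sym (freedR g ×-⇔ ⇔.refl)))
    where
    g*∉R : g* ∉ R
    g*∉R = g*∉G ∘ ∈-resp-↭ (↭-sym G↭δR) ∘ there
    freedR : ∀ g → (FreeIn P G g ⊎ g ≡ δ) ⇔ FreeIn P R g
    freedR g = ⇔.trans (free-↭ G↭δR ⊎-⇔ ⇔.refl) (free-remove _≟_ pδ (All¬⇒¬Any δ≢R))

admissible-↭ : ∀ {n Q Q*} → Admissible n Q → Q ↭ Q* →
  Unique (gaps Q*) → All (AllowedGap n) (gaps Q*) → Admissible n Q*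
admissible-↭ (inP , uQ , _) Q↭Q* uG* allG* =
  All-resp-↭ Q↭Q* inP , Unique-resp-↭ Q↭Q* uQ , uG* , allG*

reroute : ∀ {n Q Q* R δ g*} → Admissible n Q → Q ↭ Q* →
  gaps Q ↭ δ ∷ R → gaps Q* ↭ g* ∷ R → Free n Q g* →
  Admissible n Q* × (∀ g → Free n Q* g ⇔ ((Free n Q g ⊎ g ≡ δ) × g ≢ g*))
reroute adm@(_ , _ , uG , allG) Q↭Q* G↭δR G*↭g*R free
  with exchange _≟_ G↭δR G*↭g*R uG allG free
... | (uG* , allG*) , freeIff = admissible-↭ adm Q↭Q* uG* allG* , freeIff

rearrange : ∀ {n Q Q*} → Admissible n Q → Q ↭ Q* → gaps Q ↭ gaps Q* →
  Admissible n Q* × (∀ g → Free n Q* g ⇔ Free n Q g)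
rearrange {n} adm@(_ , _ , uG , allG) Q↭Q* G↭G* =
  admissible-↭ adm Q↭Q* (Unique-resp-↭ G↭G* uG) (All-resp-↭ G↭G* allG)
  , λ g → free-↭ {P = AllowedGap n} (↭-sym G↭G*)

module _ {A : Set} where

  toList-∷ʳ : (ini : List A) (x : A) → toList (ini List⁺.∷ʳ x) ≡ ini ++ [ x ]
  toList-∷ʳ []      x = refl
  toList-∷ʳ (_ ∷ _) x = refl

  toList-last : (Q : List⁺ A) → ∃ λ ini → toList Q ≡ ini ++ [ last Q ]
  toList-last Q with snocView Q
  ... | ini ∷ʳ′ x = ini , toList-∷ʳ ini x

  head-toList : (Q : List⁺ A) {x : A} {xs : List A} → toList Q ≡ x ∷ xs → head Q ≡ x
  head-toList (_ List⁺.∷ _) = ∷-injectiveˡ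

  last-toList : (Q : List⁺ A) {x : A} (xs : List A) → toList Q ≡ xs ++ [ x ] → last Q ≡ x
  last-toList Q xs Q≡xs∷ʳx with toList-last Q
  ... | ini , Q≡ini∷ʳlast = ∷ʳ-injectiveʳ ini xs (trans (sym Q≡ini∷ʳlast) Q≡xs∷ʳx)

  toList-fromVec : ∀ {m} (v : Vec.Vec A (ℕ.suc m)) → toList (List⁺.fromVec v) ≡ Vec.toList v
  toList-fromVec (_ Vec.∷ _) = refl

  toList-reverse : (Q : List⁺ A) → toList (reverse Q) ≡ List.reverse (toList Q)
  toList-reverse (x List⁺.∷ xs) = begin
    toList (List⁺.fromVec (Vec.reverse (x Vec.∷ Vec.fromList xs)))
      ≡⟨ toList-fromVec (Vec.reverse (x Vec.∷ Vec.fromList xs)) ⟩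
    Vec.toList (Vec.reverse (x Vec.∷ Vec.fromList xs))
      ≡⟨ Vec.toList-reverse (x Vec.∷ Vec.fromList xs) ⟩
    List.reverse (x ∷ Vec.toList (Vec.fromList xs))
      ≡⟨ cong (List.reverse ∘ (x ∷_)) (Vec.toList∘fromList xs) ⟩
    List.reverse (x ∷ xs)
      ∎
    where open ≡-Reasoning

  head-reverse : (Q : List⁺ A) → head (reverse Q) ≡ last Q
  head-reverse Q with toList-last Q
  ... | ini , Q≡ini∷ʳlast = head-toList (reverse Q) (begin
    toList (reverse Q)                    ≡⟨ toList-reverse Q ⟩
    List.reverse (toList Q)               ≡⟨ cong List.reverse Q≡ini∷ʳlast ⟩
    List.reverse (ini ++ [ last Q ])      ≡⟨ reverse-++ ini [ last Q ] ⟩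
    last Q ∷ List.reverse ini             ∎)
    where open ≡-Reasoning

  last-reverse : (Q : List⁺ A) → last (reverse Q) ≡ head Q
  last-reverse Q@(x List⁺.∷ xs) = last-toList (reverse Q) (List.reverse xs)
    (trans (toList-reverse Q) (unfold-reverse x xs))

  reverse-↭ : (Q : List⁺ A) → toList Q ↭ toList (reverse Q)
  reverse-↭ Q = ↭-sym (↭-trans (↭-reflexive (toList-reverse Q)) (↭-reverse (toList Q)))

gaps-split : ∀ xs a b ys → gaps (xs ++ a ∷ b ∷ ys) ≡ gaps (xs ++ [ a ]) ++ ∣ b - a ∣ ∷ gaps (b ∷ ys)
gaps-split []           a b ys = refl
gaps-split (_ ∷ [])     a b ys = refl
gaps-split (x ∷ y ∷ xs) a b ys = cong (∣ y - x ∣ ∷_) (gaps-split (y ∷ xs) a b ys)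

gaps-reverse : ∀ xs → gaps (List.reverse xs) ≡ List.reverse (gaps xs)
gaps-reverse []           = refl
gaps-reverse (_ ∷ [])     = refl
gaps-reverse (x ∷ y ∷ ys) = begin
  gaps (List.reverse (x ∷ y ∷ ys))                 ≡⟨ cong gaps reverse-pair ⟩
  gaps (List.reverse ys ++ y ∷ x ∷ [])             ≡⟨ gaps-split (List.reverse ys) y x [] ⟩
  gaps (List.reverse ys ++ [ y ]) ++ [ ∣ x - y ∣ ]  ≡⟨ cong (λ zs → gaps zs ++ [ ∣ x - y ∣ ]) (unfold-reverse y ys) ⟨
  gaps (List.reverse (y ∷ ys)) ++ [ ∣ x - y ∣ ]     ≡⟨ cong₂ (λ zs d → zs ++ [ d ]) (gaps-reverse (y ∷ ys)) (∣-∣-comm x y) ⟩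
  List.reverse (gaps (y ∷ ys)) ++ [ ∣ y - x ∣ ]     ≡⟨ unfold-reverse ∣ y - x ∣ (gaps (y ∷ ys)) ⟨
  List.reverse (gaps (x ∷ y ∷ ys))                 ∎
  where
  open ≡-Reasoning
  reverse-pair : List.reverse (x ∷ y ∷ ys) ≡ List.reverse ys ++ y ∷ x ∷ []
  reverse-pair = begin
    List.reverse (x ∷ y ∷ ys)           ≡⟨ unfold-reverse x (y ∷ ys) ⟩
    List.reverse (y ∷ ys) ++ [ x ]      ≡⟨ cong (_++ [ x ]) (unfold-reverse y ys) ⟩
    (List.reverse ys ++ [ y ]) ++ [ x ] ≡⟨ ++-assoc (List.reverse ys) [ y ] [ x ] ⟩
    List.reverse ys ++ y ∷ x ∷ []       ∎

gaps-reverse-↭ : (Q : List⁺ ℕ) → gaps (toList (reverse Q)) ↭ gaps (toList Q)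
gaps-reverse-↭ Q = begin
  gaps (toList (reverse Q))        ≡⟨ cong gaps (toList-reverse Q) ⟩
  gaps (List.reverse (toList Q))   ≡⟨ gaps-reverse (toList Q) ⟩
  List.reverse (gaps (toList Q))   ↭⟨ ↭-reverse (gaps (toList Q)) ⟩
  gaps (toList Q)                  ∎
  where open PermutationReasoning

gaps-join : (A B : List⁺ ℕ) →
  gaps (toList A ++ toList B) ↭ ∣ head B - last A ∣ ∷ (gaps (toList A) ++ gaps (toList B))
gaps-join A B@(b List⁺.∷ bs) with toList-last A
... | ini , A≡ini∷ʳlast = begin
  gaps (toList A ++ b ∷ bs)                                    ≡⟨ cong (λ as → gaps (as ++ b ∷ bs)) A≡ini∷ʳlast ⟩
  gaps ((ini ++ [ last A ]) ++ b ∷ bs)                         ≡⟨ cong gaps (++-assoc ini [ last A ] (b ∷ bs)) ⟩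
  gaps (ini ++ last A ∷ b ∷ bs)                                ≡⟨ gaps-split ini (last A) b bs ⟩
  gaps (ini ++ [ last A ]) ++ ∣ b - last A ∣ ∷ gaps (b ∷ bs)   ↭⟨ shift ∣ b - last A ∣ (gaps (ini ++ [ last A ])) (gaps (b ∷ bs)) ⟩
  ∣ b - last A ∣ ∷ (gaps (ini ++ [ last A ]) ++ gaps (b ∷ bs)) ≡⟨ cong (λ as → ∣ b - last A ∣ ∷ (gaps as ++ gaps (b ∷ bs))) A≡ini∷ʳlast ⟨
  ∣ b - last A ∣ ∷ (gaps (toList A) ++ gaps (b ∷ bs))          ∎
  where open PermutationReasoning

-- The gaps of Q₁Q₂ lying inside Q₁ or inside Q₂; they are shared by all the
-- rearrangements below, which differ only in their junction gap.
inner-gaps : (Q₁ Q₂ : List⁺ ℕ) → List ℕ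
inner-gaps Q₁ Q₂ = gaps (toList Q₁) ++ gaps (toList Q₂)

module _ (Q₁ Q₂ : List⁺ ℕ) where
  open PermutationReasoning

  gaps-reverse-left : gaps (toList (reverse Q₁) ++ toList Q₂) ↭ ∣ head Q₂ - head Q₁ ∣ ∷ inner-gaps Q₁ Q₂
  gaps-reverse-left = begin
    gaps (toList (reverse Q₁) ++ toList Q₂)
      ↭⟨ gaps-join (reverse Q₁) Q₂ ⟩
    ∣ head Q₂ - last (reverse Q₁) ∣ ∷ (gaps (toList (reverse Q₁)) ++ gaps (toList Q₂))
      ≡⟨ cong (λ v → ∣ head Q₂ - v ∣ ∷ (gaps (toList (reverse Q₁)) ++ gaps (toList Q₂))) (last-reverse Q₁) ⟩
    ∣ head Q₂ - head Q₁ ∣ ∷ (gaps (toList (reverse Q₁)) ++ gaps (toList Q₂))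
      ↭⟨ ↭-prep _ (++⁺ʳ (gaps (toList Q₂)) (gaps-reverse-↭ Q₁)) ⟩
    ∣ head Q₂ - head Q₁ ∣ ∷ inner-gaps Q₁ Q₂
      ∎

  gaps-reverse-right : gaps (toList Q₁ ++ toList (reverse Q₂)) ↭ ∣ last Q₂ - last Q₁ ∣ ∷ inner-gaps Q₁ Q₂
  gaps-reverse-right = begin
    gaps (toList Q₁ ++ toList (reverse Q₂))
      ↭⟨ gaps-join Q₁ (reverse Q₂) ⟩
    ∣ head (reverse Q₂) - last Q₁ ∣ ∷ (gaps (toList Q₁) ++ gaps (toList (reverse Q₂)))
      ≡⟨ cong (λ v → ∣ v - last Q₁ ∣ ∷ (gaps (toList Q₁) ++ gaps (toList (reverse Q₂)))) (head-reverse Q₂) ⟩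
    ∣ last Q₂ - last Q₁ ∣ ∷ (gaps (toList Q₁) ++ gaps (toList (reverse Q₂)))
      ↭⟨ ↭-prep _ (++⁺ˡ (gaps (toList Q₁)) (gaps-reverse-↭ Q₂)) ⟩
    ∣ last Q₂ - last Q₁ ∣ ∷ inner-gaps Q₁ Q₂
      ∎

  gaps-swap : gaps (toList Q₂ ++ toList Q₁) ↭ ∣ last Q₂ - head Q₁ ∣ ∷ inner-gaps Q₁ Q₂
  gaps-swap = begin
    gaps (toList Q₂ ++ toList Q₁)
      ↭⟨ gaps-join Q₂ Q₁ ⟩
    ∣ head Q₁ - last Q₂ ∣ ∷ (gaps (toList Q₂) ++ gaps (toList Q₁))
      ≡⟨ cong (_∷ (gaps (toList Q₂) ++ gaps (toList Q₁))) (∣-∣-comm (head Q₁) (last Q₂)) ⟩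
    ∣ last Q₂ - head Q₁ ∣ ∷ (gaps (toList Q₂) ++ gaps (toList Q₁))
      ↭⟨ ↭-prep _ (++-comm (gaps (toList Q₂)) (gaps (toList Q₁))) ⟩
    ∣ last Q₂ - head Q₁ ∣ ∷ inner-gaps Q₁ Q₂
      ∎

proposition4 : (n : ℕ) → 3 ≤ n → (Q₁ Q₂ : List⁺ ℕ) →
    Admissible n (toList Q₁ ++ toList Q₂) →
    length (toList Q₁ ++ toList Q₂) < n →
    ((Free n (toList Q₁ ++ toList Q₂) ∣ head Q₂ - head Q₁ ∣ →
        Admissible n (toList (reverse Q₁) ++ toList Q₂)
        × ((g : ℕ) → Free n (toList (reverse Q₁) ++ toList Q₂) g
             ⇔ ((Free n (toList Q₁ ++ toList Q₂) g ⊎ g ≡ ∣ head Q₂ - last Q₁ ∣)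
                × g ≢ ∣ head Q₂ - head Q₁ ∣)))
    × (Free n (toList Q₁ ++ toList Q₂) ∣ last Q₂ - last Q₁ ∣ →
        Admissible n (toList Q₁ ++ toList (reverse Q₂))
        × ((g : ℕ) → Free n (toList Q₁ ++ toList (reverse Q₂)) g
             ⇔ ((Free n (toList Q₁ ++ toList Q₂) g ⊎ g ≡ ∣ head Q₂ - last Q₁ ∣)
                × g ≢ ∣ last Q₂ - last Q₁ ∣)))
    × (Free n (toList Q₁ ++ toList Q₂) ∣ last Q₂ - head Q₁ ∣ →
        Admissible n (toList Q₂ ++ toList Q₁)
        × ((g : ℕ) → Free n (toList Q₂ ++ toList Q₁) g
             ⇔ ((Free n (toList Q₁ ++ toList Q₂) g ⊎ g ≡ ∣ head Q₂ - last Q₁ ∣)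
                × g ≢ ∣ last Q₂ - head Q₁ ∣)))
    × (∣ last Q₂ - head Q₁ ∣ ≡ ∣ head Q₂ - last Q₁ ∣ →
        Admissible n (toList Q₂ ++ toList Q₁)
        × ((g : ℕ) → Free n (toList Q₂ ++ toList Q₁) g
             ⇔ Free n (toList Q₁ ++ toList Q₂) g)))
proposition4 n _ Q₁ Q₂ adm _ =
    reroute adm (++⁺ʳ (toList Q₂) (reverse-↭ Q₁)) junction (gaps-reverse-left Q₁ Q₂)
  , reroute adm (++⁺ˡ (toList Q₁) (reverse-↭ Q₂)) junction (gaps-reverse-right Q₁ Q₂)
  , reroute adm swapped junction (gaps-swap Q₁ Q₂)
  , λ same-junction → rearrange adm swapped (same-gaps same-junction)
  where
  junction : gaps (toList Q₁ ++ toList Q₂) ↭ ∣ head Q₂ - last Q₁ ∣ ∷ inner-gaps Q₁ Q₂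
  junction = gaps-join Q₁ Q₂
  swapped : toList Q₁ ++ toList Q₂ ↭ toList Q₂ ++ toList Q₁
  swapped = ++-comm (toList Q₁) (toList Q₂)
  same-gaps : ∣ last Q₂ - head Q₁ ∣ ≡ ∣ head Q₂ - last Q₁ ∣ →
    gaps (toList Q₁ ++ toList Q₂) ↭ gaps (toList Q₂ ++ toList Q₁)
  same-gaps same-junction = begin
    gaps (toList Q₁ ++ toList Q₂)          ↭⟨ junction ⟩
    ∣ head Q₂ - last Q₁ ∣ ∷ inner-gaps Q₁ Q₂ ≡⟨ cong (_∷ inner-gaps Q₁ Q₂) same-junction ⟨
    ∣ last Q₂ - head Q₁ ∣ ∷ inner-gaps Q₁ Q₂ ↭⟨ gaps-swap Q₁ Q₂ ⟨
    gaps (toList Q₂ ++ toList Q₁)          ∎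
    where open PermutationReasoning
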